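{- If $B$ is a thin branch, i.e. $w_2 < n-w_1+\frac{w_1^2}{n}$ and $w_3 < n-w_2+\frac{w_2^2+(w_2-w_1)^2}{n+(w_2-w_1)}$, then the vertex with the third lowest weight in $B$ is adjacent to the vertex with the second lowest weight in $B$ (rather than to the vertex with the lowest weight).
   Context: Let $T$ be a centroidal tree with $n$ vertices, i.e. a tree whose centroid consists of a single vertex $c$. A branch of $T$ at a vertex $v$ is a maximal sub-tree of $T$ which has $v$ as a leaf; the weight $w(v)$ of a vertex $v$ is the maximum number of edges in any branch at $v$, and the centroid is the set of vertices of minimal weight. Let $B$ be a branch of $T$ at $c$ and let $w_1\le w_2\le w_3$ be the lowest, second lowest and third lowest weights of the vertices of $B$ other than $c$, attained at vertices $u,t,s$ respectively. The vertex $u$ is adjacent to $c$ and $t$ is adjacent to $u$; the vertex $s$ is a priori adjacent to either $u$ or $t$. -}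

module Defs where

open import Data.Nat using (ℕ; _+_; _*_; _∸_; _<_; _≤_)
open import Data.Fin using (Fin; toℕ)
open import Data.Bool using (Bool; true; false)
open import Data.Unit using (⊤)
open import Data.Sum using (_⊎_)
open import Data.Product using (Σ; _×_; proj₁; proj₂)
open import Data.List using (List; length)
open import Data.List.Membership.Propositional using (_∈_)
open import Data.List.Relation.Unary.Unique.Propositional using (Unique)
open import Relation.Binary.PropositionalEquality using (_≡_; _≢_)

record Graph (n : ℕ) : Set where
  field
    adj    : Fin n → Fin n → Bool
    adj-sym    : ∀ x y → adj x y ≡ adj y x
    adj-irrefl : ∀ x → adj x x ≡ false
open Graph public

Adj : ∀ {n} → Graph n → Fin n → Fin n → Set
Adj G x y = adj G x y ≡ true

data WalkIn {n} (G : Graph n) (P : Fin n → Set) : Fin n → Fin n → Set where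
  nil  : ∀ {x} → P x → WalkIn G P x x
  cons : ∀ {x y z} → WalkIn G P x y → Adj G y z → P z → WalkIn G P x z

HasSize : ∀ {A : Set} → (A → Set) → ℕ → Set
HasSize {A} P k =
  Σ (List A) λ L → Unique L × (∀ a → (a ∈ L → P a) × (P a → a ∈ L)) × length L ≡ k

-- Edges, each unordered edge {i,j} represented once as (i , j) with i < j.
IsEdge : ∀ {n} → Graph n → Fin n × Fin n → Set
IsEdge G e = toℕ (proj₁ e) < toℕ (proj₂ e) × Adj G (proj₁ e) (proj₂ e)

IsTree : ∀ {n} → Graph n → Set
IsTree {n} G = (∀ x y → WalkIn G (λ _ → ⊤) x y) × HasSize (IsEdge G) (n ∸ 1)

InComp : ∀ {n} → Graph n → Fin n → Fin n → Fin n → Set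
InComp G v x y = WalkIn G (λ z → z ≢ v) x y

-- Vertex set of the branch of T at v through the neighbour x of v:
-- v together with the component of T - v containing x.
InBranch : ∀ {n} → Graph n → Fin n → Fin n → Fin n → Set
InBranch G v x y = y ≡ v ⊎ InComp G v x y

BranchEdgeCount : ∀ {n} → Graph n → Fin n → Fin n → ℕ → Set
BranchEdgeCount G v x k =
  HasSize (λ e → IsEdge G e × InBranch G v x (proj₁ e) × InBranch G v x (proj₂ e)) k

-- w(v) = k : k is the maximum number of edges of a branch at v
-- (branches at v correspond to neighbours x of v).
IsWeight : ∀ {n} → Graph n → Fin n → ℕ → Set
IsWeight G v k =
  (Σ _ λ x → Adj G v x × BranchEdgeCount G v x k)
  × (∀ x m → Adj G v x → BranchEdgeCount G v x m → m ≤ k)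

InCentroid : ∀ {n} → Graph n → Fin n → Set
InCentroid G c = Σ ℕ λ k → IsWeight G c k × (∀ v l → IsWeight G v l → k ≤ l)

CentroidIs : ∀ {n} → Graph n → Fin n → Set
CentroidIs G c = InCentroid G c × (∀ v → InCentroid G v → v ≡ c)

-- Thin-branch conditions, multiplied through by the (positive) denominators:
--   w2 < n - w1 + w1^2 / n
--     ⇔ w2*n + w1*n < n*n + w1*w1
--   w3 < n - w2 + (w2^2 + d^2)/(n + d),  d = w2 - w1 ≥ 0
--     ⇔ w3*(n+d) + w2*(n+d) < n*(n+d) + w2*w2 + d*d
Thin : ℕ → ℕ → ℕ → ℕ → Set
Thin n w1 w2 w3 =
  (w2 * n + w1 * n < n * n + w1 * w1)
  × (w3 * (n + (w2 ∸ w1)) + w2 * (n + (w2 ∸ w1))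
       < n * (n + (w2 ∸ w1)) + w2 * w2 + (w2 ∸ w1) * (w2 ∸ w1))

-- Root the tree at c and, for a vertex x of the branch B with parent p, let σ(x) be the number of
-- edges of the branch at p through x. Since c is the unique centroid, every vertex of B is heavier
-- than c, so its heaviest branch is the one containing c and w(x) = n - σ(x). As σ strictly
-- decreases away from c, the lightest vertex u is b, the parent of t is u, and the parent of s is t
-- or u. In the latter case t and s are children of b with σ(t) + σ(s) < σ(b) = n - w₁ < w₁, and
-- elementary arithmetic shows that such weights cannot satisfy both thinness inequalities.

module Submission where

open import Defs
open import Data.Nat using (ℕ; zero; suc; _+_; _*_; _∸_; _≤_; _<_; z≤n; s≤s)
open import Data.Nat.Properties
  using (≤-trans; ≤-reflexive; ≤-antisym; +-suc; +-identityʳ; ≤-pred; <⇒≤; ≰⇒>;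
         ≮⇒≥; ≤∧≢⇒<; <-asym; n≮n; _≤?_; _<?_; +-cancelʳ-≤; +-cancelʳ-≡; +-cancelˡ-<; +-monoʳ-≤; m≤m+n; <⇒≱;
         m≤n⇒∃[o]m+o≡n; m+n∸m≡n; ≤-<-trans)
open import Data.Nat.Tactic.RingSolver using (solve-∀)
import Data.Fin as Fin
open import Data.Fin using (Fin; toℕ) renaming (_≟_ to _≟ᶠ_)
open import Data.Fin.Properties using (any?; toℕ-injective; suc-injective)
open import Data.Bool using (true; _∧_; not) renaming (_≟_ to _≟ᵇ_)
open import Data.Bool.Properties using (∧-conicalˡ; ∧-conicalʳ)
open import Data.Product using (Σ; ∃; _×_; _,_; proj₁; proj₂)
open import Data.Product.Properties using (≡-dec)
open import Data.Sum using (_⊎_; inj₁; inj₂)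
open import Data.Empty using (⊥; ⊥-elim)
open import Data.Unit using (⊤; tt)
open import Data.List using (List; []; _∷_; length; filter; map; _++_; allFin; cartesianProduct)
open import Data.List.Properties using (filter-notAll; length-++; length-map; length-tabulate)
open import Data.List.Membership.Propositional using (_∈_)
open import Data.List.Membership.Propositional.Properties
  using (∈-filter⁺; ∈-filter⁻; ∈-++⁺ˡ; ∈-++⁺ʳ; ∈-++⁻; ∈-allFin; ∈-map⁻; ∈-cartesianProduct⁺)
open import Data.List.Relation.Unary.Unique.Propositional using (Unique)
open import Data.List.Relation.Unary.AllPairs using ([]; _∷_)
import Data.List.Relation.Unary.Unique.Propositional.Properties as Unique
import Data.List.Relation.Unary.All as All
open import Data.List.Relation.Unary.All.Properties using (all-filter)
open import Data.List.Extrema.Nat using (argmax; argmax-all; f[xs]≤f[argmax])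
import Data.List.Relation.Unary.Any as Any
open import Data.List.Relation.Unary.Any using (here; there)
open import Function using (_∘_)
open import Relation.Nullary using (¬_; Dec; does; yes; no; ¬?)
open import Relation.Nullary.Decidable using (_×-dec_; _⊎-dec_; map′; decidable-stable; dec-true; dec-false)
open import Relation.Unary using (Pred; Decidable; _⊆_)
open import Relation.Binary.Definitions using (DecidableEquality)
open import Relation.Binary.PropositionalEquality using (_≡_; _≢_; refl; sym; trans; cong; cong₂; subst)

module Cardinality {A : Set} (_≟_ : DecidableEquality A) where

  private
    _≢?_ : ∀ x → Decidable (x ≢_)
    _≢?_ x = ¬? ∘ (x ≟_)

    without : A → List A → List A
    without x = filter (x ≢?_)

  unique-⊆⇒length≤ : ∀ {xs ys : List A} → Unique xs → (∀ {a} → a ∈ xs → a ∈ ys) → length xs ≤ length ys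
  unique-⊆⇒length≤ {[]} _ _ = z≤n
  unique-⊆⇒length≤ {x ∷ xs} {ys} (x∉xs ∷ xs!) xs⊆ys =
    ≤-trans (s≤s (unique-⊆⇒length≤ xs! xs⊆ys-x))
            (filter-notAll (x ≢?_) ys (Any.map (λ x≡a x≢a → x≢a x≡a) (xs⊆ys (here refl))))
    where
      xs⊆ys-x : ∀ {a} → a ∈ xs → a ∈ without x ys
      xs⊆ys-x a∈xs = ∈-filter⁺ (x ≢?_) (xs⊆ys (there a∈xs)) (All.lookup x∉xs a∈xs)

  HasSize-⊆ : ∀ {P Q : Pred A _} {k l} → HasSize P k → HasSize Q l → P ⊆ Q → k ≤ l
  HasSize-⊆ (L , L! , L↔P , refl) (M , _ , M↔Q , refl) P⊆Q =
    unique-⊆⇒length≤ L! (λ {a} a∈L → proj₂ (M↔Q a) (P⊆Q (proj₁ (L↔P a) a∈L)))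

  HasSize-unique : ∀ {P : Pred A _} {k l} → HasSize P k → HasSize P l → k ≡ l
  HasSize-unique |P|≡k |P|≡l =
    ≤-antisym (HasSize-⊆ |P|≡k |P|≡l (λ p → p)) (HasSize-⊆ |P|≡l |P|≡k (λ p → p))

  HasSize-filter : ∀ {P : Pred A _} (P? : Decidable P) {U : List A} → Unique U → (∀ a → a ∈ U)
    → HasSize P (length (filter P? U))
  HasSize-filter P? {U} U! a∈U =
    filter P? U , Unique.filter⁺ P? U! ,
    (λ a → (λ a∈ → proj₂ (∈-filter⁻ P? {xs = U} a∈)) , ∈-filter⁺ P? (a∈U a)) , refl

  HasSize-disjoint-⊂ : ∀ {R P Q : Pred A _} {N a b} (e : A) → HasSize R N → HasSize P a → HasSize Q b
    → P ⊆ R → Q ⊆ R → (∀ {x} → P x → Q x → ⊥) → R e → ¬ P e → ¬ Q e → suc (a + b) ≤ N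
  HasSize-disjoint-⊂ e (L , _ , L↔R , refl) (LP , LP! , LP↔P , refl) (LQ , LQ! , LQ↔Q , refl)
                     P⊆R Q⊆R P∩Q=∅ Re ¬Pe ¬Qe =
    ≤-trans (s≤s (≤-reflexive (sym (length-++ LP))))
            (unique-⊆⇒length≤ {e ∷ LP ++ LQ} (All.tabulate e∉ ∷ Unique.++⁺ LP! LQ! disjoint) ⊆L)
    where
      disjoint : ∀ {v} → ¬ (v ∈ LP × v ∈ LQ)
      disjoint {v} (v∈P , v∈Q) = P∩Q=∅ (proj₁ (LP↔P v) v∈P) (proj₁ (LQ↔Q v) v∈Q)
      e∉ : ∀ {v} → v ∈ LP ++ LQ → e ≢ v
      e∉ {v} v∈ refl with ∈-++⁻ LP v∈
      ... | inj₁ v∈P = ¬Pe (proj₁ (LP↔P v) v∈P)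
      ... | inj₂ v∈Q = ¬Qe (proj₁ (LQ↔Q v) v∈Q)
      ⊆L : ∀ {v} → v ∈ e ∷ LP ++ LQ → v ∈ L
      ⊆L (here refl) = proj₂ (L↔R e) Re
      ⊆L {v} (there v∈) with ∈-++⁻ LP v∈
      ... | inj₁ v∈P = proj₂ (L↔R v) (P⊆R (proj₁ (LP↔P v) v∈P))
      ... | inj₂ v∈Q = proj₂ (L↔R v) (Q⊆R (proj₁ (LQ↔Q v) v∈Q))

  HasSize-⊂ : ∀ {P Q : Pred A _} {k l} (e : A) → HasSize P k → HasSize Q l → P ⊆ Q → Q e → ¬ P e → k < l
  HasSize-⊂ {k = k} e |P| |Q| P⊆Q Qe ¬Pe =
    subst (_< _) (+-identityʳ k)
      (HasSize-disjoint-⊂ {Q = λ _ → ⊥} e |Q| |P| ([] , [] , (λ _ → (λ ()) , λ ()) , refl)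
                          P⊆Q (λ ()) (λ _ ()) Qe ¬Pe (λ ()))

  HasSize-cover : ∀ {R P Q : Pred A _} {N a b} (e : A) → HasSize R N → HasSize P a → HasSize Q b
    → (∀ {x} → R x → P x ⊎ Q x) → P e → Q e → suc N ≤ a + b
  HasSize-cover e (L , L! , L↔R , refl) (LP , _ , LP↔P , refl) (LQ , _ , LQ↔Q , refl) cover Pe Qe =
    ≤-trans (s≤s L≤) (≤-trans (≤-reflexive (sym (+-suc (length LP) _))) (+-monoʳ-≤ (length LP) LQ-e<LQ))
    where
      L≤ : length L ≤ length LP + length (without e LQ)
      L≤ = ≤-trans (unique-⊆⇒length≤ L! ⊆) (≤-reflexive (length-++ LP))
        where
          ⊆ : ∀ {x} → x ∈ L → x ∈ LP ++ without e LQ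
          ⊆ {x} x∈L with cover (proj₁ (L↔R x) x∈L)
          ... | inj₁ Px = ∈-++⁺ˡ (proj₂ (LP↔P x) Px)
          ... | inj₂ Qx with e ≟ x
          ...   | yes refl = ∈-++⁺ˡ (proj₂ (LP↔P x) Pe)
          ...   | no e≢x = ∈-++⁺ʳ LP (∈-filter⁺ (e ≢?_) (proj₂ (LQ↔Q x) Qx) e≢x)
      LQ-e<LQ : length (without e LQ) < length LQ
      LQ-e<LQ = filter-notAll (e ≢?_) LQ (Any.map (λ e≡x e≢x → e≢x e≡x) (proj₂ (LQ↔Q e) Qe))

  HasSize-almostDisjoint : ∀ {R P Q : Pred A _} {N a b} (e : A) → HasSize R N → HasSize P a → HasSize Q b
    → P ⊆ R → Q ⊆ R → (∀ {x} → P x → Q x → x ≡ e) → a + b ≤ suc N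
  HasSize-almostDisjoint e (L , _ , L↔R , refl) (LP , LP! , LP↔P , refl) (LQ , LQ! , LQ↔Q , refl)
                         P⊆R Q⊆R P∩Q⊆e =
    ≤-trans (+-monoʳ-≤ (length LP) LQ≤) (≤-trans (≤-reflexive (+-suc (length LP) _)) (s≤s LP+LQ-e≤L))
    where
      LQ-e! : Unique (without e LQ)
      LQ-e! = Unique.filter⁺ (e ≢?_) LQ!
      LQ≤ : length LQ ≤ suc (length (without e LQ))
      LQ≤ = unique-⊆⇒length≤ LQ! ⊆
        where
          ⊆ : ∀ {x} → x ∈ LQ → x ∈ e ∷ without e LQ
          ⊆ {x} x∈ with e ≟ x
          ... | yes refl = here refl
          ... | no e≢x = there (∈-filter⁺ (e ≢?_) x∈ e≢x)
      disjoint : ∀ {v} → ¬ (v ∈ LP × v ∈ without e LQ)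
      disjoint {v} (v∈P , v∈Q-e) with ∈-filter⁻ (e ≢?_) {xs = LQ} v∈Q-e
      ... | v∈Q , e≢v = e≢v (sym (P∩Q⊆e (proj₁ (LP↔P v) v∈P) (proj₁ (LQ↔Q v) v∈Q)))
      LP+LQ-e≤L : length LP + length (without e LQ) ≤ length L
      LP+LQ-e≤L =
        ≤-trans (≤-reflexive (sym (length-++ LP))) (unique-⊆⇒length≤ (Unique.++⁺ LP! LQ-e! disjoint) ⊆)
        where
          ⊆ : ∀ {x} → x ∈ LP ++ without e LQ → x ∈ L
          ⊆ {x} x∈ with ∈-++⁻ LP x∈
          ... | inj₁ x∈P = proj₂ (L↔R x) (P⊆R (proj₁ (LP↔P x) x∈P))
          ... | inj₂ x∈Q-e with ∈-filter⁻ (e ≢?_) {xs = LQ} x∈Q-e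
          ...   | x∈Q , _ = proj₂ (L↔R x) (Q⊆R (proj₁ (LQ↔Q x) x∈Q))

module Walks {n : ℕ} (G : Graph n) where

  Adj-sym : ∀ {x y} → Adj G x y → Adj G y x
  Adj-sym {x} {y} x~y = trans (adj-sym G y x) x~y

  Adj? : ∀ x y → Dec (Adj G x y)
  Adj? x y = adj G x y ≟ᵇ true

  Adj⇒≢ : ∀ {x y} → Adj G x y → x ≢ y
  Adj⇒≢ {x} x~x refl with trans (sym x~x) (adj-irrefl G x)
  ... | ()

  private variable
    P Q : Fin n → Set

  walk-start : ∀ {x y} → WalkIn G P x y → P x
  walk-start (nil px) = px
  walk-start (cons w _ _) = walk-start w

  walk-end : ∀ {x y} → WalkIn G P x y → P y
  walk-end (nil py) = py
  walk-end (cons _ _ py) = py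

  infixr 5 _++ʷ_ _◅ʷ_

  _++ʷ_ : ∀ {x y z} → WalkIn G P x y → WalkIn G P y z → WalkIn G P x z
  w ++ʷ nil _ = w
  w ++ʷ cons w′ y~z pz = cons (w ++ʷ w′) y~z pz

  _◅ʷ_ : ∀ {x y z} → Adj G x y × P x → WalkIn G P y z → WalkIn G P x z
  (x~y , px) ◅ʷ w = cons (nil px) x~y (walk-start w) ++ʷ w

  reverseʷ : ∀ {x y} → WalkIn G P x y → WalkIn G P y x
  reverseʷ (nil px) = nil px
  reverseʷ (cons w y~z pz) = (Adj-sym y~z , pz) ◅ʷ reverseʷ w

  splitLast : ∀ {a b} (v : Fin n) → WalkIn G P a b →
    WalkIn G (λ z → P z × z ≢ v) a b
    ⊎ (P v × (v ≡ b ⊎ Σ (Fin n) λ y → Adj G v y × WalkIn G (λ z → P z × z ≢ v) y b))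
  splitLast {a = a} v (nil pa) with a ≟ᶠ v
  ... | yes refl = inj₂ (pa , inj₁ refl)
  ... | no a≢v = inj₁ (nil (pa , a≢v))
  splitLast v (cons {z = z} w y~z pz) with z ≟ᶠ v
  ... | yes refl = inj₂ (pz , inj₁ refl)
  ... | no z≢v with splitLast v w
  ...   | inj₁ w′ = inj₁ (cons w′ y~z (pz , z≢v))
  ...   | inj₂ (pv , inj₁ refl) = inj₂ (pv , inj₂ (z , y~z , nil (pz , z≢v)))
  ...   | inj₂ (pv , inj₂ (y , v~y , w′)) = inj₂ (pv , inj₂ (y , v~y , cons w′ y~z (pz , z≢v)))

  splitFirst : ∀ {a b} (v : Fin n) → WalkIn G P a b →
    WalkIn G (λ z → P z × z ≢ v) a b
    ⊎ (P v × (a ≡ v ⊎ Σ (Fin n) λ y → WalkIn G (λ z → P z × z ≢ v) a y × Adj G y v))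
  splitFirst v w with splitLast v (reverseʷ w)
  ... | inj₁ w′ = inj₁ (reverseʷ w′)
  ... | inj₂ (pv , inj₁ v≡a) = inj₂ (pv , inj₁ (sym v≡a))
  ... | inj₂ (pv , inj₂ (y , v~y , w′)) = inj₂ (pv , inj₂ (y , reverseʷ w′ , Adj-sym v~y))

  walk-map : P ⊆ Q → ∀ {x y} → WalkIn G P x y → WalkIn G Q x y
  walk-map P⊆Q (nil px) = nil (P⊆Q px)
  walk-map P⊆Q (cons w y~z pz) = cons (walk-map P⊆Q w) y~z (P⊆Q pz)

module Reachability {n : ℕ} (G : Graph n) {P : Fin n → Set} (P? : Decidable P) (x : Fin n) where

  open Walks G
  open Cardinality (_≟ᶠ_ {n})

  Layer : ℕ → Fin n → Set
  Layer zero    z = P z × z ≡ x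
  Layer (suc k) z = Layer k z ⊎ (P z × ∃ λ y → Layer k y × Adj G y z)

  layer? : ∀ k → Decidable (Layer k)
  layer? zero    z = P? z ×-dec z ≟ᶠ x
  layer? (suc k) z = layer? k z ⊎-dec (P? z ×-dec any? (λ y → layer? k y ×-dec Adj? y z))

  Layer⇒walk : ∀ {k z} → Layer k z → WalkIn G P x z
  Layer⇒walk {zero} (pz , refl) = nil pz
  Layer⇒walk {suc k} (inj₁ z∈k) = Layer⇒walk z∈k
  Layer⇒walk {suc k} (inj₂ (pz , y , y∈k , y~z)) = cons (Layer⇒walk y∈k) y~z pz

  walkLength : ∀ {a b} → WalkIn G P a b → ℕ
  walkLength (nil _) = zero
  walkLength (cons w _ _) = suc (walkLength w)

  walk⇒Layer : ∀ {z} (w : WalkIn G P x z) → Layer (walkLength w) z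
  walk⇒Layer (nil px) = px , refl
  walk⇒Layer (cons w y~z pz) = inj₂ (pz , _ , walk⇒Layer w , y~z)

  Layer-mono : ∀ {k l} → k ≤ l → Layer k ⊆ Layer l
  Layer-mono {l = zero} z≤n z∈k = z∈k
  Layer-mono {zero} {suc l} z≤n z∈k = inj₁ (Layer-mono z≤n z∈k)
  Layer-mono {suc k} {suc l} k≤l (inj₁ z∈k) = inj₁ (Layer-mono (≤-pred k≤l) z∈k)
  Layer-mono {suc k} {suc l} k≤l (inj₂ (pz , y , y∈k , y~z)) =
    inj₂ (pz , y , Layer-mono (≤-pred k≤l) y∈k , y~z)

  Layer-suc-mono : ∀ {k l} → Layer k ⊆ Layer l → Layer (suc k) ⊆ Layer (suc l)
  Layer-suc-mono k⊆l (inj₁ z∈k) = inj₁ (k⊆l z∈k)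
  Layer-suc-mono k⊆l (inj₂ (pz , y , y∈k , y~z)) = inj₂ (pz , y , k⊆l y∈k , y~z)

  Stable : ℕ → Set
  Stable k = Layer (suc k) ⊆ Layer k

  layerSize : ℕ → ℕ
  layerSize k = length (filter (layer? k) (allFin n))

  layerSize-correct : ∀ k → HasSize (Layer k) (layerSize k)
  layerSize-correct k = HasSize-filter (layer? k) (Unique.allFin⁺ n) ∈-allFin

  layerSize≤n : ∀ k → layerSize k ≤ n
  layerSize≤n k = HasSize-⊆ (layerSize-correct k) all (λ _ → tt)
    where
      all : HasSize {Fin n} (λ _ → ⊤) n
      all = allFin n , Unique.allFin⁺ n , (λ a → (λ _ → tt) , (λ _ → ∈-allFin a)) , length-tabulate (λ i → i)

  stable-or-grows : ∀ k → Stable k ⊎ layerSize k < layerSize (suc k)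
  stable-or-grows k with any? (λ z → layer? (suc k) z ×-dec ¬? (layer? k z))
  ... | yes (z , z∈k+1 , z∉k) =
        inj₂ (HasSize-⊂ z (layerSize-correct k) (layerSize-correct (suc k)) inj₁ z∈k+1 z∉k)
  ... | no none = inj₁ (λ {z} z∈k+1 → decidable-stable (layer? k z) (λ z∉k → none (z , z∈k+1 , z∉k)))

  -- The layers grow strictly until they stabilise, and there are only n vertices.
  stable-or-large : ∀ k → Stable k ⊎ k ≤ layerSize k
  stable-or-large zero = inj₂ z≤n
  stable-or-large (suc k) with stable-or-large k | stable-or-grows k
  ... | _ | inj₁ stable = inj₁ (Layer-suc-mono stable)
  ... | inj₁ stable | inj₂ _ = inj₁ (Layer-suc-mono stable)
  ... | inj₂ k≤ | inj₂ grows = inj₂ (≤-trans (s≤s k≤) grows)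

  Layer⊆final : ∀ k → Layer k ⊆ Layer (suc n)
  Layer⊆final zero = Layer-mono z≤n
  Layer⊆final (suc k) z∈k+1 with stable-or-large (suc n)
  ... | inj₁ stable = stable (Layer-suc-mono (Layer⊆final k) z∈k+1)
  ... | inj₂ n+1≤ = ⊥-elim (n≮n n (≤-trans n+1≤ (layerSize≤n (suc n))))

  walk? : Decidable (WalkIn G P x)
  walk? z = map′ Layer⇒walk (λ w → Layer⊆final (walkLength w) (walk⇒Layer w)) (layer? (suc n) z)

  leastLayer : ∀ {k z} → Layer k z → ∃ λ j → Layer j z × (∀ {i} → Layer i z → j ≤ i)
  leastLayer {zero} z∈0 = zero , z∈0 , λ _ → z≤n
  leastLayer {suc k} {z} z∈k+1 with layer? k z
  ... | yes z∈k = leastLayer z∈k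
  ... | no z∉k = suc k , z∈k+1 , least
    where
      least : ∀ {i} → Layer i z → suc k ≤ i
      least {i} z∈i with suc k ≤? i
      ... | yes k<i = k<i
      ... | no k≮i = ⊥-elim (z∉k (Layer-mono (≤-pred (≰⇒> k≮i)) z∈i))

  closer-neighbour : ∀ {z} → WalkIn G P x z → z ≢ x
    → ∃ λ k → ∃ λ y → Layer k y × Adj G y z × (∀ {j} → Layer j z → k < j)
  closer-neighbour w z≢x with leastLayer (walk⇒Layer w)
  ... | zero , (_ , z≡x) , _ = ⊥-elim (z≢x z≡x)
  ... | suc k , inj₁ z∈k , least = ⊥-elim (n≮n k (least z∈k))
  ... | suc k , inj₂ (_ , y , y∈k , y~z) , least = k , y , y∈k , y~z , least

module EdgeEncoding {n : ℕ} where

  _≟ᵖ_ : DecidableEquality (Fin n × Fin n)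
  _≟ᵖ_ = ≡-dec _≟ᶠ_ _≟ᶠ_

  allPairs : List (Fin n × Fin n)
  allPairs = cartesianProduct (allFin n) (allFin n)

  allPairs-unique : Unique allPairs
  allPairs-unique = Unique.cartesianProduct⁺ (Unique.allFin⁺ n) (Unique.allFin⁺ n)

  ∈-allPairs : ∀ p → p ∈ allPairs
  ∈-allPairs (a , b) = ∈-cartesianProduct⁺ (∈-allFin a) (∈-allFin b)

  edgeOf : Fin n → Fin n → Fin n × Fin n
  edgeOf a b with toℕ a <? toℕ b
  ... | yes _ = a , b
  ... | no _ = b , a

  SameEnds : Fin n → Fin n → Fin n → Fin n → Set
  SameEnds a b c d = (a ≡ c × b ≡ d) ⊎ (a ≡ d × b ≡ c)

  edgeOf-injective : ∀ {a b c d} → edgeOf a b ≡ edgeOf c d → SameEnds a b c d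
  edgeOf-injective {a} {b} {c} {d} eq with toℕ a <? toℕ b | toℕ c <? toℕ d
  ... | yes _ | yes _ = inj₁ (cong proj₁ eq , cong proj₂ eq)
  ... | yes _ | no _  = inj₂ (cong proj₁ eq , cong proj₂ eq)
  ... | no _  | yes _ = inj₂ (cong proj₂ eq , cong proj₁ eq)
  ... | no _  | no _  = inj₁ (cong proj₂ eq , cong proj₁ eq)

  edgeOf-comm : ∀ a b → edgeOf a b ≡ edgeOf b a
  edgeOf-comm a b with toℕ a <? toℕ b | toℕ b <? toℕ a
  ... | yes a<b | yes b<a = ⊥-elim (<-asym a<b b<a)
  ... | yes _   | no _    = refl
  ... | no _    | yes _   = refl
  ... | no a≮b  | no b≮a with toℕ-injective (≤-antisym (≮⇒≥ b≮a) (≮⇒≥ a≮b))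
  ...   | refl = refl

  ordered⇒≡edgeOf : ∀ {a b} → toℕ a < toℕ b → (a , b) ≡ edgeOf a b
  ordered⇒≡edgeOf {a} {b} a<b with toℕ a <? toℕ b
  ... | yes _ = refl
  ... | no a≮b = ⊥-elim (a≮b a<b)

  edgeOf-ends⁺ : ∀ {a b} (P : Fin n → Set) → P a → P b → P (proj₁ (edgeOf a b)) × P (proj₂ (edgeOf a b))
  edgeOf-ends⁺ {a} {b} P pa pb with toℕ a <? toℕ b
  ... | yes _ = pa , pb
  ... | no _ = pb , pa

  edgeOf-ends⁻ : ∀ {a b} (P : Fin n → Set) → P (proj₁ (edgeOf a b)) → P (proj₂ (edgeOf a b)) → P a × P b
  edgeOf-ends⁻ {a} {b} P p₁ p₂ with toℕ a <? toℕ b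
  ... | yes _ = p₁ , p₂
  ... | no _ = p₂ , p₁

module Edges {n : ℕ} (G : Graph n) where

  open Walks G
  open EdgeEncoding

  isEdge? : Decidable (IsEdge G)
  isEdge? (a , b) = toℕ a <? toℕ b ×-dec Adj? a b

  Adj⇒IsEdge : ∀ {a b} → Adj G a b → IsEdge G (edgeOf a b)
  Adj⇒IsEdge {a} {b} a~b with toℕ a <? toℕ b
  ... | yes a<b = a<b , a~b
  ... | no a≮b = ≤∧≢⇒< (≮⇒≥ a≮b) (λ b≡a → Adj⇒≢ a~b (toℕ-injective (sym b≡a))) , Adj-sym a~b


-- Sending each non-root vertex to the edge towards a neighbour in an earlier BFS layer is injective.
connected⇒edges≥ : ∀ {n} (G : Graph n) → (∀ a b → WalkIn G (λ _ → ⊤) a b)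
  → ∀ {m} → HasSize (IsEdge G) m → n ∸ 1 ≤ m
connected⇒edges≥ {zero} _ _ _ = z≤n
connected⇒edges≥ {suc n} G connected (L , _ , L↔E , refl) =
  ≤-trans (≤-reflexive (sym (trans (length-map edgeToRoot (allFin n)) (length-tabulate (λ i → i)))))
          (unique-⊆⇒length≤ (Unique.map⁺ edgeToRoot-injective (Unique.allFin⁺ n)) image⊆L)
  where
    open Walks G
    open EdgeEncoding
    open Edges G
    open Cardinality _≟ᵖ_
    open Reachability G (λ _ → yes tt) Fin.zero

    closer : (i : Fin n)
      → ∃ λ k → ∃ λ y → Layer k y × Adj G y (Fin.suc i) × (∀ {j} → Layer j (Fin.suc i) → k < j)
    closer i = closer-neighbour (connected Fin.zero (Fin.suc i)) (λ ())

    edgeToRoot : Fin n → Fin (suc n) × Fin (suc n)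
    edgeToRoot i = edgeOf (Fin.suc i) (proj₁ (proj₂ (closer i)))

    edgeToRoot-injective : ∀ {i j} → edgeToRoot i ≡ edgeToRoot j → i ≡ j
    edgeToRoot-injective {i} {j} eq with closer i | closer j | edgeOf-injective {a = Fin.suc i} eq
    ... | _ | _ | inj₁ (i≡j , _) = suc-injective i≡j
    ... | k , _ , y∈k , _ , k<i | l , _ , z∈l , _ , l<j | inj₂ (refl , refl) =
          ⊥-elim (<-asym (k<i z∈l) (l<j y∈k))

    image⊆L : ∀ {e} → e ∈ map edgeToRoot (allFin n) → e ∈ L
    image⊆L e∈ with ∈-map⁻ edgeToRoot e∈
    ... | i , _ , refl =
          proj₂ (L↔E (edgeToRoot i)) (Adj⇒IsEdge (Adj-sym (proj₁ (proj₂ (proj₂ (proj₂ (closer i)))))))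

module EdgeDeletion {n : ℕ} (G : Graph n) (x y : Fin n) where

  open EdgeEncoding

  deleteEdge : Graph n
  deleteEdge = record
    { adj        = λ a b → adj G a b ∧ not (does (edgeOf a b ≟ᵖ edgeOf x y))
    ; adj-sym    = λ a b →
        cong₂ _∧_ (adj-sym G a b) (cong (λ e → not (does (e ≟ᵖ edgeOf x y))) (edgeOf-comm a b))
    ; adj-irrefl = λ a → cong (_∧ _) (adj-irrefl G a)
    }

  deleteEdge-keeps : ∀ {a b} → Adj G a b → ¬ SameEnds a b x y → Adj deleteEdge a b
  deleteEdge-keeps {a} {b} a~b ab≠xy =
    cong₂ _∧_ a~b (cong not (dec-false (edgeOf a b ≟ᵖ edgeOf x y) (ab≠xy ∘ edgeOf-injective)))

  deleteEdge-⊆ : IsEdge deleteEdge ⊆ IsEdge G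
  deleteEdge-⊆ (a<b , a~b) = a<b , ∧-conicalˡ _ _ a~b

  deleteEdge-removes : ¬ IsEdge deleteEdge (edgeOf x y)
  deleteEdge-removes = removes refl
    where
      removes : ∀ {e} → e ≡ edgeOf x y → ¬ IsEdge deleteEdge e
      removes {a , b} e≡xy (a<b , a~b)
        with trans (sym (cong not (dec-true (edgeOf a b ≟ᵖ edgeOf x y) (trans (sym (ordered⇒≡edgeOf a<b)) e≡xy))))
                   (∧-conicalʳ _ _ a~b)
      ... | ()

-- Deleting the edge xy from a tree leaves a connected graph with too few edges
-- unless x and y lie on different sides of it.
tree-edge-separates : ∀ {n} {G : Graph n} → IsTree G → ∀ {x y z} → Adj G x y
  → WalkIn G (λ v → v ≢ x) y z → WalkIn G (λ v → v ≢ y) x z → ⊥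
tree-edge-separates {n} {G} (connected , |E|) {x} {y} x~y y⇝z x⇝z =
  n≮n m (≤-trans (HasSize-⊂ (edgeOf x y) |E′| |E| deleteEdge-⊆ (Adj⇒IsEdge x~y) deleteEdge-removes)
                 (connected⇒edges≥ deleteEdge connected′ |E′|))
  where
    open EdgeEncoding
    open Cardinality _≟ᵖ_
    open Edges G using (Adj⇒IsEdge)
    open EdgeDeletion G x y
    open Walks G using (splitFirst; walk-end)
    open Walks deleteEdge using (_++ʷ_; reverseʷ)

    m : ℕ
    m = length (filter (Edges.isEdge? deleteEdge) allPairs)

    |E′| : HasSize (IsEdge deleteEdge) m
    |E′| = HasSize-filter (Edges.isEdge? deleteEdge) allPairs-unique ∈-allPairs

    lift : ∀ {Q : Fin n → Set} → (∀ {a b} → Q a → Q b → ¬ SameEnds a b x y)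
      → ∀ {a b} → WalkIn G Q a b → WalkIn deleteEdge (λ _ → ⊤) a b
    lift ok (nil _) = nil tt
    lift ok (cons w a~b qb) = cons (lift ok w) (deleteEdge-keeps a~b (ok (walk-end w) qb)) tt

    avoids-x : ∀ {a b} → a ≢ x → b ≢ x → ¬ SameEnds a b x y
    avoids-x a≢x _ (inj₁ (a≡x , _)) = a≢x a≡x
    avoids-x _ b≢x (inj₂ (_ , b≡x)) = b≢x b≡x

    avoids-y : ∀ {a b} → a ≢ y → b ≢ y → ¬ SameEnds a b x y
    avoids-y _ b≢y (inj₁ (_ , b≡y)) = b≢y b≡y
    avoids-y a≢y _ (inj₂ (a≡y , _)) = a≢y a≡y

    avoids-xy : ∀ {a b} → a ≢ x → a ≢ y → ¬ SameEnds a b x y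
    avoids-xy a≢x _ (inj₁ (a≡x , _)) = a≢x a≡x
    avoids-xy _ a≢y (inj₂ (a≡y , _)) = a≢y a≡y

    y⇝x : WalkIn deleteEdge (λ _ → ⊤) y x
    y⇝x = lift avoids-x y⇝z ++ʷ reverseʷ (lift avoids-y x⇝z)

    then-step : ∀ {v p w} → WalkIn G (λ z → (⊤ × z ≢ x) × z ≢ y) v p → Adj G p w
      → WalkIn deleteEdge (λ _ → ⊤) v w
    then-step v⇝p p~w =
      cons (lift (λ a b → avoids-x (proj₂ (proj₁ a)) (proj₂ (proj₁ b))) v⇝p)
           (deleteEdge-keeps p~w (avoids-xy (proj₂ (proj₁ (walk-end v⇝p))) (proj₂ (walk-end v⇝p)))) tt

    -- Follow a walk from v to x up to its first visit to x or y.
    ⇝x : ∀ v → WalkIn deleteEdge (λ _ → ⊤) v x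
    ⇝x v with splitFirst x (connected v x)
    ... | inj₁ v⇝x = ⊥-elim (proj₂ (walk-end v⇝x) refl)
    ... | inj₂ (_ , inj₁ refl) = nil tt
    ... | inj₂ (_ , inj₂ (p , v⇝p , p~x)) with splitFirst y v⇝p
    ...   | inj₁ v⇝p′ = then-step v⇝p′ p~x
    ...   | inj₂ (_ , inj₁ refl) = y⇝x
    ...   | inj₂ (_ , inj₂ (q , v⇝q , q~y)) = then-step v⇝q q~y ++ʷ y⇝x

    connected′ : ∀ a b → WalkIn deleteEdge (λ _ → ⊤) a b
    connected′ a b = ⇝x a ++ʷ reverseʷ (⇝x b)

module Branches {n : ℕ} (G : Graph n) (tree : IsTree G) where

  open Walks G
  open EdgeEncoding
  open Edges G
  open Cardinality (_≟ᵖ_ {n})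

  inBranch? : ∀ v x → Decidable (InBranch G v x)
  inBranch? v x y = y ≟ᶠ v ⊎-dec Reachability.walk? G (λ z → ¬? (z ≟ᶠ v)) x y

  BranchEdge : Fin n → Fin n → Fin n × Fin n → Set
  BranchEdge v x e = IsEdge G e × InBranch G v x (proj₁ e) × InBranch G v x (proj₂ e)

  branchEdge? : ∀ v x → Decidable (BranchEdge v x)
  branchEdge? v x (a , b) = isEdge? (a , b) ×-dec inBranch? v x a ×-dec inBranch? v x b

  branchSize : Fin n → Fin n → ℕ
  branchSize v x = length (filter (branchEdge? v x) allPairs)

  branchSize-correct : ∀ v x → BranchEdgeCount G v x (branchSize v x)
  branchSize-correct v x = HasSize-filter (branchEdge? v x) allPairs-unique ∈-allPairs

  BranchEdgeCount⇒≡branchSize : ∀ {v x k} → BranchEdgeCount G v x k → k ≡ branchSize v x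
  BranchEdgeCount⇒≡branchSize |B| = HasSize-unique |B| (branchSize-correct _ _)

  root∈branch : ∀ {v x} → InBranch G v x v
  root∈branch = inj₁ refl

  neighbour∈branch : ∀ {v x} → Adj G v x → InBranch G v x x
  neighbour∈branch v~x = inj₂ (nil (λ x≡v → Adj⇒≢ v~x (sym x≡v)))

  edgeOf∈branch : ∀ {v x} → Adj G v x → BranchEdge v x (edgeOf v x)
  edgeOf∈branch {v} {x} v~x = Adj⇒IsEdge v~x , edgeOf-ends⁺ (InBranch G v x) root∈branch (neighbour∈branch v~x)

  ∉branch⇒∈opposite : ∀ {x y p} → Adj G x y → ¬ InBranch G x y p → InComp G y x p
  ∉branch⇒∈opposite {x} {y} {p} x~y p∉ with splitFirst x (proj₁ tree p x)
  ... | inj₁ p⇝x = ⊥-elim (proj₂ (walk-end p⇝x) refl)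
  ... | inj₂ (_ , inj₁ refl) = ⊥-elim (p∉ root∈branch)
  ... | inj₂ (_ , inj₂ (q , p⇝q , q~x)) with splitFirst y p⇝q
  ...   | inj₁ p⇝q′ = reverseʷ (cons (walk-map proj₂ p⇝q′) q~x (Adj⇒≢ x~y))
  ...   | inj₂ (_ , inj₁ refl) = ⊥-elim (p∉ (neighbour∈branch x~y))
  ...   | inj₂ (_ , inj₂ (q′ , p⇝q′ , q′~y)) =
          ⊥-elim (p∉ (inj₂ (reverseʷ (cons (walk-map (proj₂ ∘ proj₁) p⇝q′) q′~y (Adj⇒≢ x~y ∘ sym)))))

  component-step : ∀ {x y p q} → Adj G p q → InComp G y x p → InBranch G y x q
  component-step {y = y} {q = q} p~q x⇝p with q ≟ᶠ y
  ... | yes q≡y = inj₁ q≡y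
  ... | no q≢y = inj₂ (cons x⇝p p~q q≢y)

  in-both-branches : ∀ {x y p} → Adj G x y → InBranch G x y p → InBranch G y x p → p ≡ x ⊎ p ≡ y
  in-both-branches _ (inj₁ p≡x) _ = inj₁ p≡x
  in-both-branches _ (inj₂ _) (inj₁ p≡y) = inj₂ p≡y
  in-both-branches x~y (inj₂ y⇝p) (inj₂ x⇝p) = ⊥-elim (tree-edge-separates tree x~y y⇝p x⇝p)

  private
    suc-∸1 : ∀ {m} → Fin m → suc (m ∸ 1) ≡ m
    suc-∸1 {suc m} _ = refl

  -- The two branches at the ends of an edge share exactly that edge and cover the tree.
  branchSize-complement : ∀ {x y} → Adj G x y → branchSize x y + branchSize y x ≡ n
  branchSize-complement {x} {y} x~y = ≤-antisym
    (subst (branchSize x y + branchSize y x ≤_) (suc-∸1 x)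
      (HasSize-almostDisjoint (edgeOf x y) (proj₂ tree) (branchSize-correct x y) (branchSize-correct y x)
                              proj₁ proj₁ shared))
    (subst (_≤ branchSize x y + branchSize y x) (suc-∸1 x)
      (HasSize-cover (edgeOf x y) (proj₂ tree) (branchSize-correct x y) (branchSize-correct y x) cover
        (edgeOf∈branch x~y) (subst (BranchEdge y x) (edgeOf-comm y x) (edgeOf∈branch (Adj-sym x~y)))))
    where
      cover : ∀ {e} → IsEdge G e → BranchEdge x y e ⊎ BranchEdge y x e
      cover {p , q} e@(_ , p~q) with inBranch? x y p | inBranch? x y q
      ... | yes p∈ | yes q∈ = inj₁ (e , p∈ , q∈)
      ... | no p∉ | _ = let y⇝p = ∉branch⇒∈opposite x~y p∉ in inj₂ (e , inj₂ y⇝p , component-step p~q y⇝p)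
      ... | yes _ | no q∉ = let y⇝q = ∉branch⇒∈opposite x~y q∉ in inj₂ (e , component-step (Adj-sym p~q) y⇝q , inj₂ y⇝q)
      shared : ∀ {e} → BranchEdge x y e → BranchEdge y x e → e ≡ edgeOf x y
      shared {p , q} (e , p∈xy , q∈xy) (_ , p∈yx , q∈yx)
        with in-both-branches x~y p∈xy p∈yx | in-both-branches x~y q∈xy q∈yx
      ... | inj₁ refl | inj₁ refl = ⊥-elim (n≮n _ (proj₁ e))
      ... | inj₁ refl | inj₂ refl = ordered⇒≡edgeOf (proj₁ e)
      ... | inj₂ refl | inj₁ refl = trans (ordered⇒≡edgeOf (proj₁ e)) (edgeOf-comm y x)
      ... | inj₂ refl | inj₂ refl = ⊥-elim (n≮n _ (proj₁ e))

  module _ {x y z : Fin n} (x~y : Adj G x y) (y~z : Adj G y z) (z≢x : z ≢ x) where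

    ∉branch-beyond : ¬ InBranch G y z x
    ∉branch-beyond (inj₁ x≡y) = Adj⇒≢ x~y x≡y
    ∉branch-beyond (inj₂ z⇝x) =
      tree-edge-separates tree y~z z⇝x (cons (nil (Adj⇒≢ y~z)) (Adj-sym x~y) (z≢x ∘ sym))

    branch-beyond-⊆ : InBranch G y z ⊆ InBranch G x y
    branch-beyond-⊆ (inj₁ refl) = neighbour∈branch x~y
    branch-beyond-⊆ (inj₂ z⇝v) with splitFirst x z⇝v
    ... | inj₁ z⇝v′ = inj₂ (cons (nil (Adj⇒≢ x~y ∘ sym)) y~z z≢x ++ʷ walk-map proj₂ z⇝v′)
    ... | inj₂ (_ , inj₁ z≡x) = ⊥-elim (z≢x z≡x)
    ... | inj₂ (_ , inj₂ (q , z⇝q , q~x)) =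
          ⊥-elim (∉branch-beyond (inj₂ (cons (walk-map proj₁ z⇝q) q~x (Adj⇒≢ x~y))))

    branchEdge-beyond-⊆ : BranchEdge y z ⊆ BranchEdge x y
    branchEdge-beyond-⊆ (e , a∈ , b∈) = e , branch-beyond-⊆ a∈ , branch-beyond-⊆ b∈

    edgeOf∉branch-beyond : ¬ BranchEdge y z (edgeOf x y)
    edgeOf∉branch-beyond (_ , x∈ , y∈) = ∉branch-beyond (proj₁ (edgeOf-ends⁻ {a = x} {b = y} (InBranch G y z) x∈ y∈))

    branchSize-beyond< : branchSize y z < branchSize x y
    branchSize-beyond< = HasSize-⊂ (edgeOf x y) (branchSize-correct y z) (branchSize-correct x y)
                           branchEdge-beyond-⊆ (edgeOf∈branch x~y) edgeOf∉branch-beyond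

  branchSize-siblings : ∀ {p v t s} → Adj G p v → Adj G v t → Adj G v s → t ≢ p → s ≢ p → t ≢ s
    → branchSize v t + branchSize v s < branchSize p v
  branchSize-siblings {p} {v} {t} {s} p~v v~t v~s t≢p s≢p t≢s =
    HasSize-disjoint-⊂ (edgeOf p v) (branchSize-correct p v) (branchSize-correct v t) (branchSize-correct v s)
      (branchEdge-beyond-⊆ p~v v~t t≢p) (branchEdge-beyond-⊆ p~v v~s s≢p) disjoint
      (edgeOf∈branch p~v) (edgeOf∉branch-beyond p~v v~t t≢p) (edgeOf∉branch-beyond p~v v~s s≢p)
    where
      common : ∀ {z} → InBranch G v t z → InBranch G v s z → z ≢ v → ⊥
      common (inj₁ z≡v) _ z≢v = z≢v z≡v
      common (inj₂ _) (inj₁ z≡v) z≢v = z≢v z≡v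
      common (inj₂ t⇝z) (inj₂ s⇝z) _ =
        tree-edge-separates tree v~t (t⇝z ++ʷ reverseʷ s⇝z) (cons (nil (Adj⇒≢ v~t)) v~s (t≢s ∘ sym))
      disjoint : ∀ {e} → BranchEdge v t e → BranchEdge v s e → ⊥
      disjoint {a , b} ((a<b , _) , a∈t , b∈t) (_ , a∈s , b∈s) with a ≟ᶠ v
      ... | no a≢v = common a∈t a∈s a≢v
      ... | yes refl = common b∈t b∈s (λ { refl → n≮n _ a<b })

  neighbours : Fin n → List (Fin n)
  neighbours x = filter (Adj? x) (allFin n)

  weight-exists : ∀ {x y} → Adj G x y → ∃ (IsWeight G x)
  weight-exists {x} {y} x~y =
    branchSize x z , (z , x~z , branchSize-correct x z) , heaviest
    where
      z : Fin n
      z = argmax (branchSize x) y (neighbours x)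
      x~z : Adj G x z
      x~z = argmax-all (branchSize x) x~y (all-filter (Adj? x) (allFin n))
      heaviest : ∀ w m → Adj G x w → BranchEdgeCount G x w m → m ≤ branchSize x z
      heaviest w m x~w |B| = subst (_≤ branchSize x z) (sym (BranchEdgeCount⇒≡branchSize |B|))
        (All.lookup (f[xs]≤f[argmax] {f = branchSize x} y (neighbours x)) (∈-filter⁺ _ (∈-allFin w) x~w))

  -- Every branch at x other than the one through p lies inside the branch at p through x.
  weight-towards : ∀ {x p k} → Adj G x p → IsWeight G x k → branchSize p x < k → k + branchSize p x ≡ n
  weight-towards {x} {p} x~p ((y , x~y , |B|) , _) p-side<k with y ≟ᶠ p
  ... | yes refl = trans (cong (_+ branchSize p x) (BranchEdgeCount⇒≡branchSize |B|)) (branchSize-complement x~p)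
  ... | no y≢p = ⊥-elim (<-asym p-side<k
          (subst (_< branchSize p x) (sym (BranchEdgeCount⇒≡branchSize |B|))
                 (branchSize-beyond< (Adj-sym x~p) x~y y≢p)))

module RootedTree {n : ℕ} (G : Graph n) (tree : IsTree G) (c : Fin n) where

  open Walks G
  open EdgeEncoding
  open Branches G tree
  open Cardinality (_≟ᵖ_ {n})

  -- p is the parent of x in the tree rooted at c: the neighbour of x on the side of c.
  IsParent : Fin n → Fin n → Set
  IsParent x p = Adj G x p × InComp G x p c

  parent-exists : ∀ {x} → x ≢ c → ∃ (IsParent x)
  parent-exists {x} x≢c with splitFirst x (proj₁ tree c x)
  ... | inj₁ c⇝x = ⊥-elim (proj₂ (walk-end c⇝x) refl)
  ... | inj₂ (_ , inj₁ c≡x) = ⊥-elim (x≢c (sym c≡x))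
  ... | inj₂ (_ , inj₂ (p , c⇝p , p~x)) = p , Adj-sym p~x , reverseʷ (walk-map proj₂ c⇝p)

  parent-not-child : ∀ {x p q} → IsParent x p → IsParent p q → x ≢ q
  parent-not-child (x~p , p⇝c) (_ , x⇝c) refl = tree-edge-separates tree x~p p⇝c x⇝c

  root∉branch : ∀ {x p} → IsParent x p → p ≢ c → ¬ InBranch G p x c
  root∉branch _ p≢c (inj₁ c≡p) = p≢c (sym c≡p)
  root∉branch (x~p , p⇝c) _ (inj₂ x⇝c) = tree-edge-separates tree (Adj-sym x~p) x⇝c p⇝c

  module Component {b : Fin n} (c~b : Adj G c b) where

    b∈component : InComp G c b b
    b∈component = nil (Adj⇒≢ c~b ∘ sym)

    b-parent : IsParent b c
    b-parent = Adj-sym c~b , nil (Adj⇒≢ c~b)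

    ∈component⇒≢root : ∀ {x} → InComp G c b x → x ≢ c
    ∈component⇒≢root = walk-end

    child∈component : ∀ {x} → IsParent x b → InComp G c b x
    child∈component (x~b , b⇝c) = cons b∈component (Adj-sym x~b) (walk-end b⇝c ∘ sym)

    neighbour-of-root⇒≡b : ∀ {x} → InComp G c b x → Adj G x c → x ≡ b
    neighbour-of-root⇒≡b {x} b⇝x x~c = decidable-stable (x ≟ᶠ b) λ x≢b →
      tree-edge-separates tree (Adj-sym x~c) (reverseʷ b⇝x) (cons (nil (Adj⇒≢ (Adj-sym x~c))) c~b (x≢b ∘ sym))

    parent∈component : ∀ {x p} → InComp G c b x → IsParent x p → p ≢ c → InComp G c b p
    parent∈component b⇝x (x~p , _) p≢c = cons b⇝x x~p p≢c

    branch-at-parent-⊆ : ∀ {x p} → InComp G c b x → IsParent x p → p ≢ c → InBranch G p x ⊆ InBranch G c b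
    branch-at-parent-⊆ b⇝x x-p p≢c (inj₁ refl) = inj₂ (parent∈component b⇝x x-p p≢c)
    branch-at-parent-⊆ b⇝x x-p p≢c (inj₂ x⇝z) with splitFirst c x⇝z
    ... | inj₁ x⇝z′ = inj₂ (b⇝x ++ʷ walk-map proj₂ x⇝z′)
    ... | inj₂ (_ , inj₁ x≡c) = ⊥-elim (∈component⇒≢root b⇝x x≡c)
    ... | inj₂ (_ , inj₂ (q , x⇝q , q~c)) =
          ⊥-elim (root∉branch x-p p≢c (inj₂ (cons (walk-map proj₁ x⇝q) q~c (p≢c ∘ sym))))

    branchSize-inner< : ∀ {x p} → InComp G c b x → IsParent x p → p ≢ c → branchSize p x < branchSize c b
    branchSize-inner< b⇝x x-p p≢c =
      HasSize-⊂ (edgeOf c b) (branchSize-correct _ _) (branchSize-correct c b)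
        (λ (e , a∈ , b∈) → e , branch-at-parent-⊆ b⇝x x-p p≢c a∈ , branch-at-parent-⊆ b⇝x x-p p≢c b∈)
        (edgeOf∈branch c~b) edgeOf-cb∉
      where
        edgeOf-cb∉ : ¬ BranchEdge _ _ (edgeOf c b)
        edgeOf-cb∉ (_ , c∈ , b∈) = root∉branch x-p p≢c (proj₁ (edgeOf-ends⁻ {a = c} {b = b} (InBranch G _ _) c∈ b∈))

    branchSize-parent≤ : ∀ {x p} → InComp G c b x → IsParent x p → branchSize p x ≤ branchSize c b
    branchSize-parent≤ {x} {p} b⇝x x-p with p ≟ᶠ c
    ... | yes refl = ≤-reflexive (cong (branchSize c) (neighbour-of-root⇒≡b b⇝x (proj₁ x-p)))
    ... | no p≢c = <⇒≤ (branchSize-inner< b⇝x x-p p≢c)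

    branchSize-parent< : ∀ {x p} → InComp G c b x → x ≢ b → IsParent x p → branchSize p x < branchSize c b
    branchSize-parent< {x} {p} b⇝x x≢b x-p with p ≟ᶠ c
    ... | yes refl = ⊥-elim (x≢b (neighbour-of-root⇒≡b b⇝x (proj₁ x-p)))
    ... | no p≢c = branchSize-inner< b⇝x x-p p≢c

complement-< : ∀ {n a b x y} → a + x ≡ n → b + y ≡ n → x < y → b < a
complement-< {n} {a} {b} {x} {y} a+x≡n b+y≡n x<y =
  +-cancelʳ-≤ x (suc b) a
    (≤-trans (≤-reflexive (sym (+-suc b x))) (≤-trans (+-monoʳ-≤ b x<y) (≤-reflexive (trans b+y≡n (sym a+x≡n)))))

private
  -- Substituting a = m + d, w₁ = a + 1 + r, n = w₁ + a and w₂ = w₁ + d (so d = w₂ - w₁), the slack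
  -- of the first thinness inequality is a polynomial with natural coefficients when m ≤ d (d = m + e),
  -- and with w₃ = w₁ + m + 1 + q that of the second one when d < m (m = d + 1 + e, d = m′ + 1 + q).
  thin₁-slack : ∀ m e r → let d = m + e; a = m + d; w₁ = suc (a + r); n = w₁ + a; w₂ = w₁ + d in
    w₂ * n + w₁ * n ≡ (n * n + w₁ * w₁) + (e + e * e + 2 * e * m + e * r + m + m * r)
  thin₁-slack = solve-∀

  thin₂-slack : ∀ m′ q e r → let d = suc (m′ + q); m = suc (d + e); a = m + d; w₁ = suc (a + r); n = w₁ + a
                                 w₂ = w₁ + d; w₃ = w₁ + (m + suc q) in
    w₃ * (n + d) + w₂ * (n + d) ≡ (n * (n + d) + w₂ * w₂ + d * d)
      + (14 + 8 * e + e * e + 3 * e * m′ + 5 * e * q + e * r + 9 * m′ + 5 * m′ * q + m′ * r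
         + 17 * q + 5 * q * q + 2 * q * r + 3 * r)
  thin₂-slack = solve-∀

  w₂-shape : ∀ m d r → let a = m + d in suc (a + r) + a ≡ (suc (a + r) + d) + m
  w₂-shape = solve-∀

  w₃-shape : ∀ m′ q e r → let d = suc (m′ + q); m = suc (d + e); a = m + d in
    suc (a + r) + a ≡ (suc (a + r) + (m + suc q)) + m′
  w₃-shape = solve-∀

  slack⇒≮ : ∀ {l r} p → l ≡ r + p → ¬ (l < r)
  slack⇒≮ {r = r} p l≡r+p l<r = <⇒≱ l<r (≤-trans (m≤m+n r p) (≤-reflexive (sym l≡r+p)))

  thin₂-at : ∀ {n w₁ w₂ w₃ d} → w₂ ∸ w₁ ≡ d → Thin n w₁ w₂ w₃
    → w₃ * (n + d) + w₂ * (n + d) < n * (n + d) + w₂ * w₂ + d * d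
  thin₂-at refl = proj₂

sizes-not-thin : ∀ {n w₁ w₂ w₃ a m m′} → w₁ + a ≡ n → w₂ + m ≡ n → w₃ + m′ ≡ n → a < w₁ → m + m′ < a
  → ¬ Thin n w₁ w₂ w₃
sizes-not-thin {w₂ = w₂} {w₃} {m = m} {m′} eq₁ eq₂ eq₃ a<w₁ m+m′<a thin
  with m≤n⇒∃[o]m+o≡n a<w₁ | m≤n⇒∃[o]m+o≡n (≤-trans (m≤m+n m m′) (<⇒≤ m+m′<a))
... | r , refl | d , refl with eq₁
... | refl with +-cancelʳ-≡ m w₂ _ (trans eq₂ (w₂-shape m d r))
... | refl with m ≤? d
... | yes m≤d with m≤n⇒∃[o]m+o≡n m≤d
...   | e , refl = slack⇒≮ _ (thin₁-slack m e r) (proj₁ thin)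
sizes-not-thin {w₃ = w₃} {m = m} {m′} eq₁ eq₂ eq₃ a<w₁ m+m′<a thin
  | r , refl | d , refl | refl | refl | no m≰d
  with m≤n⇒∃[o]m+o≡n (≰⇒> m≰d) | m≤n⇒∃[o]m+o≡n (+-cancelˡ-< m m′ d m+m′<a)
... | e , refl | q , refl with +-cancelʳ-≡ m′ w₃ _ (trans eq₃ (w₃-shape m′ q e r))
... | refl = slack⇒≮ _ (thin₂-slack m′ q e r)
               (thin₂-at {n = suc (m + d + r) + (m + d)} {suc (m + d + r)} {suc (m + d + r) + d} {w₃}
                         (m+n∸m≡n (suc (m + d + r)) d) thin)

module CentroidBranch {n : ℕ} {G : Graph n} (tree : IsTree G) {c : Fin n} (centroid : CentroidIs G c)
                      {b : Fin n} (c~b : Adj G c b) where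

  open Walks G
  open Branches G tree
  open RootedTree G tree c
  open Component c~b public

  -- Every vertex of the branch is heavier than c, since c is the only centroid vertex.
  branchSize<weight : ∀ {x k} → InComp G c b x → IsWeight G x k → branchSize c b < k
  branchSize<weight {x} {k} b⇝x x-k =
    ≤-<-trans (proj₂ c-k₀ b (branchSize c b) c~b (branchSize-correct c b))
              (≤∧≢⇒< (k₀-min x k x-k) (∈component⇒≢root b⇝x ∘ x∈centroid))
    where
      k₀ : ℕ
      k₀ = proj₁ (proj₁ centroid)
      c-k₀ : IsWeight G c k₀
      c-k₀ = proj₁ (proj₂ (proj₁ centroid))
      k₀-min : ∀ v l → IsWeight G v l → k₀ ≤ l
      k₀-min = proj₂ (proj₂ (proj₁ centroid))
      x∈centroid : k₀ ≡ k → x ≡ c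
      x∈centroid k₀≡k = proj₂ centroid x (k , x-k , λ v l v-l → subst (_≤ l) k₀≡k (k₀-min v l v-l))

  weight-complement : ∀ {x p k} → InComp G c b x → IsParent x p → IsWeight G x k → k + branchSize p x ≡ n
  weight-complement b⇝x x-p x-k =
    weight-towards (proj₁ x-p) x-k (≤-<-trans (branchSize-parent≤ b⇝x x-p) (branchSize<weight b⇝x x-k))

  lightest≡b : ∀ {u w} → InComp G c b u → IsWeight G u w
    → (∀ x k → InComp G c b x → IsWeight G x k → w ≤ k) → u ≡ b
  lightest≡b {u} b⇝u u-w w-min = decidable-stable (u ≟ᶠ b) λ u≢b →
    let (p , u-p) = parent-exists (∈component⇒≢root b⇝u)
        (l , b-l) = weight-exists (Adj-sym c~b)
    in <⇒≱ (complement-< (weight-complement b⇝u u-p u-w) (weight-complement b∈component b-parent b-l)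
                          (branchSize-parent< b⇝u u≢b u-p))
           (w-min b l b∈component b-l)

  parent-lighter : ∀ {x p k} → InComp G c b x → x ≢ b → IsParent x p → IsWeight G x k
    → ∃ λ l → InComp G c b p × IsWeight G p l × l < k
  parent-lighter {p = p} b⇝x x≢b x-p x-k with p ≟ᶠ c
  ... | yes refl = ⊥-elim (x≢b (neighbour-of-root⇒≡b b⇝x (proj₁ x-p)))
  ... | no p≢c =
    let b⇝p = parent∈component b⇝x x-p p≢c
        (q , p-q) = parent-exists p≢c
        (l , p-l) = weight-exists (Adj-sym (proj₁ x-p))
    in l , b⇝p , p-l ,
       complement-< (weight-complement b⇝x x-p x-k) (weight-complement b⇝p p-q p-l)
         (branchSize-beyond< (Adj-sym (proj₁ p-q)) (Adj-sym (proj₁ x-p)) (parent-not-child x-p p-q))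

  siblings-not-thin : ∀ {t s w₁ w₂ w₃} → IsParent t b → IsParent s b → t ≢ s
    → IsWeight G b w₁ → IsWeight G t w₂ → IsWeight G s w₃ → ¬ Thin n w₁ w₂ w₃
  siblings-not-thin t-b s-b t≢s b-w₁ t-w₂ s-w₃ =
    sizes-not-thin (weight-complement b∈component b-parent b-w₁)
                   (weight-complement (child∈component t-b) t-b t-w₂)
                   (weight-complement (child∈component s-b) s-b s-w₃)
                   (branchSize<weight b∈component b-w₁)
                   (branchSize-siblings c~b (Adj-sym (proj₁ t-b)) (Adj-sym (proj₁ s-b))
                     (∈component⇒≢root (child∈component t-b)) (∈component⇒≢root (child∈component s-b)) t≢s)

mainTheorem6 : (n : ℕ) (T : Graph n) → IsTree T
    → (c : Fin n) → CentroidIs T c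
    → (b : Fin n) → Adj T c b
    → (u t s : Fin n) (w₁ w₂ w₃ : ℕ)
    → InComp T c b u → IsWeight T u w₁
    → (∀ x k → InComp T c b x → IsWeight T x k → w₁ ≤ k)
    → InComp T c b t → t ≢ u → IsWeight T t w₂
    → (∀ x k → InComp T c b x → x ≢ u → IsWeight T x k → w₂ ≤ k)
    → InComp T c b s → s ≢ u → s ≢ t → IsWeight T s w₃
    → (∀ x k → InComp T c b x → x ≢ u → x ≢ t → IsWeight T x k → w₃ ≤ k)
    → Thin n w₁ w₂ w₃
    → Adj T s t
mainTheorem6 n T tree c centroid b c~b u t s w₁ w₂ w₃
             b⇝u u-w₁ w₁-min b⇝t t≢u t-w₂ w₂-min b⇝s s≢u s≢t s-w₃ w₃-min thin =
  let (q , s-q) = parent-exists (∈component⇒≢root b⇝s) in subst (Adj T s) (s-parent≡t s-q) (proj₁ s-q)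
  where
    open RootedTree T tree c using (IsParent; parent-exists)
    open CentroidBranch tree centroid c~b

    u≡b : u ≡ b
    u≡b = lightest≡b b⇝u u-w₁ w₁-min

    ≢u⇒≢b : ∀ {x} → x ≢ u → x ≢ b
    ≢u⇒≢b x≢u x≡b = x≢u (trans x≡b (sym u≡b))

    t-parent≡b : ∀ {p} → IsParent t p → p ≡ b
    t-parent≡b {p} t-p =
      let (l , b⇝p , p-l , l<w₂) = parent-lighter b⇝t (≢u⇒≢b t≢u) t-p t-w₂
      in trans (decidable-stable (p ≟ᶠ u) λ p≢u → <⇒≱ l<w₂ (w₂-min p l b⇝p p≢u p-l)) u≡b

    s-parent≡t : ∀ {q} → IsParent s q → q ≡ t
    s-parent≡t {q} s-q =
      let (l , b⇝q , q-l , l<w₃) = parent-lighter b⇝s (≢u⇒≢b s≢u) s-q s-w₃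
      in decidable-stable (q ≟ᶠ t) λ q≢t →
           let q≡u = decidable-stable (q ≟ᶠ u) λ q≢u → <⇒≱ l<w₃ (w₃-min q l b⇝q q≢u q≢t q-l)
               (p , t-p) = parent-exists (∈component⇒≢root b⇝t)
           in siblings-not-thin (subst (IsParent t) (t-parent≡b t-p) t-p) (subst (IsParent s) (trans q≡u u≡b) s-q)
                (s≢t ∘ sym)
                (subst (λ v → IsWeight T v w₁) u≡b u-w₁) t-w₂ s-w₃ thin
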